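{- For every positive integer $m$, $h(m)\ge \binom{\lfloor 3m/2\rfloor}{m}$; that is, there exists a family of $m$-element sets with property $Q$ having $\binom{\lfloor 3m/2\rfloor}{m}$ members.
   Context: A family $\mathcal F$ of $m$-element sets has property $Q$ if for every positive integer $k$ and any $F_1,\dots,F_k\in\mathcal F$ we have $\left|\bigcup_{i=1}^k F_i\right|\le \sum_{i=1}^k\lfloor m/i\rfloor$. $h(m)$ denotes the largest cardinality of a family of $m$-element sets with property $Q$. -}

module Defs where

open import Data.Nat using (ℕ; zero; suc; _+_; _≤_; _/_)
open import Data.Fin using (Fin)
open import Data.Fin.Subset using (Subset; ∣_∣; ⋃)
open import Data.List using (List; tabulate)
open import Data.List.Membership.Propositional using (_∈_)

floorSum : ℕ → ℕ → ℕ
floorSum m zero = 0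
floorSum m (suc k) = floorSum m k + m / suc k

PropertyQ : {n : ℕ} → ℕ → List (Subset n) → Set
PropertyQ {n} m 𝓕 =
  (k : ℕ) → 1 ≤ k → (F : Fin k → Subset n) → ((i : Fin k) → F i ∈ 𝓕) →
  ∣ ⋃ (tabulate F) ∣ ≤ floorSum m k

module Submission where

-- Construction: take ALL m-element subsets of a ground set of N = ⌊3m/2⌋
-- points; there are N C m of them.  Property Q holds for this family for a
-- reason that has nothing to do with its particular members:
--   * for k = 1 the union is a single member, of size m = ⌊m/1⌋;
--   * for k ≥ 2 the union lies inside the ground set, so its size is at most
--     N = m + ⌊m/2⌋ = Σ_{i≤2} ⌊m/i⌋ ≤ Σ_{i≤k} ⌊m/i⌋.

open import Defs
open import Data.Nat using (ℕ; zero; suc; _+_; _*_; _/_; _≤_; z≤n; s≤s)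
open import Data.Nat.Properties
  using (≤-refl; ≤-trans; ≤-reflexive; m≤m+n; m≤n⇒m<n∨m≡n; *-comm; *-distribˡ-+; *-identityʳ)
open import Data.Nat.DivMod using (n/1≡n; m*n/n≡m; +-distrib-/-∣ˡ)
open import Data.Nat.Divisibility using (divides-refl)
open import Data.Nat.Combinatorics using (_C_; nCk+nC[k+1]≡[n+1]C[k+1])
open import Data.Product using (Σ; _×_; _,_)
open import Data.Sum using (inj₁; inj₂)
open import Data.List using (List; []; _∷_; [_]; _++_; map; length; tabulate)
open import Data.List.Properties using (length-map; length-++)
open import Data.List.Relation.Unary.All as All using (All; []; _∷_)
import Data.List.Relation.Unary.All.Properties as Allₚ
open import Data.List.Relation.Unary.Unique.Propositional using (Unique; []; _∷_)
import Data.List.Relation.Unary.Unique.Propositional.Properties as Uniqueₚ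
open import Data.List.Relation.Binary.Disjoint.Propositional using (Disjoint)
open import Data.List.Membership.Propositional.Properties using (∈-map⁻)
open import Data.Vec using ([]; _∷_)
open import Data.Vec.Properties using (∷-injectiveʳ)
open import Data.Fin using (Fin)
open import Data.Fin.Subset using (Subset; inside; outside; ∣_∣; ⋃)
open import Data.Fin.Subset.Properties using (∣p∣≤n; ∪-identityʳ)
open import Relation.Binary.PropositionalEquality using (_≡_; refl; cong; sym; trans)
open Relation.Binary.PropositionalEquality.≡-Reasoning

subsetsOfSize : (n k : ℕ) → List (Subset n)
subsetsOfSize zero    zero    = [ [] ]
subsetsOfSize zero    (suc k) = []
subsetsOfSize (suc n) zero    = map (outside ∷_) (subsetsOfSize n zero)
subsetsOfSize (suc n) (suc k) =
  map (inside ∷_) (subsetsOfSize n k) ++ map (outside ∷_) (subsetsOfSize n (suc k))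

-- Counting the list is Pascal's rule.
length-subsetsOfSize : ∀ n k → length (subsetsOfSize n k) ≡ n C k
length-subsetsOfSize zero    zero    = refl
length-subsetsOfSize zero    (suc k) = refl
length-subsetsOfSize (suc n) zero    =
  trans (length-map _ (subsetsOfSize n zero)) (length-subsetsOfSize n zero)
length-subsetsOfSize (suc n) (suc k) = begin
  length (map (inside ∷_) with-first ++ map (outside ∷_) without-first)
    ≡⟨ length-++ (map (inside ∷_) with-first) ⟩
  length (map (inside ∷_) with-first) + length (map (outside ∷_) without-first)
    ≡⟨ cong (_+ length (map (outside ∷_) without-first)) (length-map _ with-first) ⟩
  length with-first + length (map (outside ∷_) without-first)
    ≡⟨ cong (length with-first +_) (length-map _ without-first) ⟩
  length with-first + length without-first
    ≡⟨ cong (_+ length without-first) (length-subsetsOfSize n k) ⟩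
  n C k + length without-first
    ≡⟨ cong (n C k +_) (length-subsetsOfSize n (suc k)) ⟩
  n C k + n C suc k
    ≡⟨ nCk+nC[k+1]≡[n+1]C[k+1] n k ⟩
  suc n C suc k ∎
  where
  with-first    = subsetsOfSize n k
  without-first = subsetsOfSize n (suc k)

subsetsOfSize-size : ∀ n k → All (λ p → ∣ p ∣ ≡ k) (subsetsOfSize n k)
subsetsOfSize-size zero    zero    = refl ∷ []
subsetsOfSize-size zero    (suc k) = []
subsetsOfSize-size (suc n) zero    = Allₚ.map⁺ (subsetsOfSize-size n zero)
subsetsOfSize-size (suc n) (suc k) =
  Allₚ.++⁺ (Allₚ.map⁺ (All.map (cong suc) (subsetsOfSize-size n k)))
           (Allₚ.map⁺ (subsetsOfSize-size n (suc k)))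

inside-outside-disjoint : ∀ {n} (ps qs : List (Subset n)) →
  Disjoint (map (inside ∷_) ps) (map (outside ∷_) qs)
inside-outside-disjoint ps qs (p∈ , q∈) with ∈-map⁻ (inside ∷_) p∈ | ∈-map⁻ (outside ∷_) q∈
... | _ , _ , refl | _ , _ , ()

subsetsOfSize-unique : ∀ n k → Unique (subsetsOfSize n k)
subsetsOfSize-unique zero    zero    = [] ∷ []
subsetsOfSize-unique zero    (suc k) = []
subsetsOfSize-unique (suc n) zero    =
  Uniqueₚ.map⁺ ∷-injectiveʳ (subsetsOfSize-unique n zero)
subsetsOfSize-unique (suc n) (suc k) =
  Uniqueₚ.++⁺ (Uniqueₚ.map⁺ ∷-injectiveʳ (subsetsOfSize-unique n k))
              (Uniqueₚ.map⁺ ∷-injectiveʳ (subsetsOfSize-unique n (suc k)))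
              (inside-outside-disjoint (subsetsOfSize n k) (subsetsOfSize n (suc k)))

floorSum-mono : ∀ m {j k} → j ≤ k → floorSum m j ≤ floorSum m k
floorSum-mono m {k = zero} z≤n = ≤-refl
floorSum-mono m {k = suc k} j≤1+k with m≤n⇒m<n∨m≡n j≤1+k
... | inj₁ (s≤s j≤k) = ≤-trans (floorSum-mono m j≤k) (m≤m+n (floorSum m k) (m / suc k))
... | inj₂ refl      = ≤-refl

floorSum-two : ∀ m → floorSum m 2 ≡ (3 * m) / 2
floorSum-two m = begin
  m / 1 + m / 2      ≡⟨ cong (_+ m / 2) (n/1≡n m) ⟩
  m + m / 2          ≡⟨ cong (_+ m / 2) (sym (m*n/n≡m m 2)) ⟩
  m * 2 / 2 + m / 2  ≡⟨ sym (+-distrib-/-∣ˡ m (divides-refl m)) ⟩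
  (m * 2 + m) / 2    ≡⟨ cong (_/ 2) three-m ⟩
  (3 * m) / 2        ∎
  where
  three-m : m * 2 + m ≡ 3 * m
  three-m = begin
    m * 2 + m      ≡⟨ cong (m * 2 +_) (sym (*-identityʳ m)) ⟩
    m * 2 + m * 1  ≡⟨ sym (*-distribˡ-+ m 2 1) ⟩
    m * 3          ≡⟨ *-comm m 3 ⟩
    3 * m          ∎

small-ground-set⇒Q : ∀ {n} m (𝓕 : List (Subset n)) → n ≤ floorSum m 2 →
  All (λ F → ∣ F ∣ ≡ m) 𝓕 → PropertyQ m 𝓕
small-ground-set⇒Q m 𝓕 _ sizes zero () F F∈𝓕
small-ground-set⇒Q m 𝓕 _ sizes (suc zero) _ F F∈𝓕 = ≤-reflexive (begin
  ∣ ⋃ [ F Fin.zero ] ∣  ≡⟨ cong ∣_∣ (∪-identityʳ (F Fin.zero)) ⟩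
  ∣ F Fin.zero ∣        ≡⟨ All.lookup sizes (F∈𝓕 Fin.zero) ⟩
  m                     ≡⟨ sym (n/1≡n m) ⟩
  floorSum m 1          ∎)
small-ground-set⇒Q m 𝓕 n≤ _ (suc (suc k)) _ F _ =
  ≤-trans (∣p∣≤n (⋃ (tabulate F)))
          (≤-trans n≤ (floorSum-mono m {2} (s≤s (s≤s z≤n))))

proposition1 : (m : ℕ) → 1 ≤ m →
    Σ ℕ (λ n → Σ (List (Subset n)) (λ 𝓕 →
      Unique 𝓕 × All (λ F → ∣ F ∣ ≡ m) 𝓕 × PropertyQ m 𝓕 ×
      length 𝓕 ≡ ((3 * m) / 2) C m))
proposition1 m _ =
  N , 𝓕 , subsetsOfSize-unique N m , sizes ,
  small-ground-set⇒Q m 𝓕 (≤-reflexive (sym (floorSum-two m))) sizes ,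
  length-subsetsOfSize N m
  where
  N = (3 * m) / 2
  𝓕 = subsetsOfSize N m
  sizes = subsetsOfSize-size N m
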